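{- Let $\sigma$ be an $r$-signotope on $[n]$ with corresponding partial order $\prec$, and let $\prec_{\mathrm{rot}}$ be the partial order corresponding to $\sigma_{\mathrm{rot}}$. For two $(r-1)$-subsets $I,J$ of $[n]$ with $I\prec J$ and $1\notin I\cap J$, either $I_{\mathrm{rot}}$ and $J_{\mathrm{rot}}$ are incomparable in $\prec_{\mathrm{rot}}$, or $I_{\mathrm{rot}}\prec_{\mathrm{rot}}J_{\mathrm{rot}}$.
   Context: An $r$-signotope on $[n]$ is a map $\sigma:\binom{[n]}{r}\to\{+,-\}$ such that for every $(r+1)$-subset $X=\{x_1<\dots<x_{r+1}\}$ the sequence $\sigma(X_1),\dots,\sigma(X_{r+1})$ has at most one sign change, where $X_j=X\setminus\{x_j\}$. The partial order $\prec$ corresponding to $\sigma$ is the transitive closure of the relations on $(r-1)$-subsets: for every $r$-subset $X=\{x_1<\dots<x_r\}$, $X_1\succ\dots\succ X_r$ if $\sigma(X)=+$ and $X_1\prec\dots\prec X_r$ if $\sigma(X)=-$. The clockwise rotation is $\sigma_{\mathrm{rot}}(x_1,\dots,x_r)=-\sigma(1,x_1+1,\dots,x_{r-1}+1)$ if $x_r=n$ and $\sigma_{\mathrm{rot}}(x_1,\dots,x_r)=\sigma(x_1+1,\dots,x_r+1)$ if $x_r<n$ (for $x_1<\dots<x_r$); it is again an $r$-signotope. For $x\in[n]$ let $x_{\mathrm{rot}}=x-1$ if $x\ne1$ and $1_{\mathrm{rot}}=n$, and $X_{\mathrm{rot}}=\{x_{\mathrm{rot}}:x\in X\}$. -}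

module Defs where

open import Data.Bool using (true; false)
open import Data.Nat using (ℕ; zero; suc; _≤_)
import Data.Nat as ℕ
open import Data.Fin using (Fin; zero; suc; fromℕ; inject₁; _<_)
open import Data.Vec using (Vec; []; _∷_; removeAt; map; _∷ʳ_; init; last; tabulate)
open import Data.Vec.Relation.Unary.Linked using (Linked)
open import Data.Sign using (Sign; +; -; opposite)
import Data.Sign as Sign
import Data.Fin as Fin
open import Data.Product using (Σ; _×_; _,_)
open import Data.Sum using (_⊎_)
open import Relation.Nullary using (¬_; does)
open import Relation.Binary.PropositionalEquality using (_≡_)
open import Relation.Binary.Construct.Closure.Transitive using (TransClosure)

-- Ground set [n] = {1,...,n} is represented by Fin n: the element i ∈ [n] is
-- the Fin value with toℕ = i - 1 (so 1 ↦ zero and n = suc m ↦ fromℕ m).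
-- A k-subset {x₁ < … < x_k} is represented by the strictly increasing
-- vector (x₁ , … , x_k).
Increasing : ∀ {n k} → Vec (Fin n) k → Set
Increasing = Linked _<_

changeAt : Sign → Sign → ℕ
changeAt a b with does (a Sign.≟ b)
... | true  = 0
... | false = 1

signChanges : ∀ {m} → Vec Sign m → ℕ
signChanges [] = 0
signChanges (a ∷ []) = 0
signChanges (a ∷ b ∷ xs) = changeAt a b ℕ.+ signChanges (b ∷ xs)

-- An r-signotope on [n], with r = suc k: a sign on every r-subset
-- (values on non-increasing vectors are irrelevant) such that for every
-- (r+1)-subset X the sequence σ(X₁), …, σ(X_{r+1}) has at most one sign change,
-- where X_j = X ∖ {x_j} = removeAt X j.
IsSignotope : ∀ {n} k → (Vec (Fin n) (suc k) → Sign) → Set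
IsSignotope {n} k σ =
  ∀ (X : Vec (Fin n) (suc (suc k))) → Increasing X →
    signChanges (tabulate (λ j → σ (removeAt X j))) ≤ 1

-- Generating relations of the order on (r-1)-subsets (r = suc k):
-- for an r-subset X = {x₁ < … < x_r}, X₁ ≻ … ≻ X_r if σ(X) = + and
-- X₁ ≺ … ≺ X_r if σ(X) = -.  Step σ A B means "A ≺ B" is one such
-- relation between consecutive X_j, X_{j+1}.
Step : ∀ {n k} → (Vec (Fin n) (suc k) → Sign) → Vec (Fin n) k → Vec (Fin n) k → Set
Step {n} {k} σ A B =
  Σ (Vec (Fin n) (suc k)) λ X → Increasing X × Σ (Fin k) λ j →
      (σ X ≡ - × A ≡ removeAt X (inject₁ j) × B ≡ removeAt X (suc j))
    ⊎ (σ X ≡ + × A ≡ removeAt X (suc j) × B ≡ removeAt X (inject₁ j))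

Prec : ∀ {n k} → (Vec (Fin n) (suc k) → Sign) → Vec (Fin n) k → Vec (Fin n) k → Set
Prec σ = TransClosure (Step σ)

-- Cyclic shifts on [n] = [suc m]:  x ↦ x + 1 (for x < n) and x_rot = x - 1, 1_rot = n.
succ : ∀ {m} → Fin (suc m) → Fin (suc m)
succ {zero} zero = zero
succ {suc m} zero = suc zero
succ {suc m} (suc x) with succ x
... | zero  = zero
... | suc y = suc (suc y)

pointRot : ∀ {m} → Fin (suc m) → Fin (suc m)
pointRot {m} zero = fromℕ m
pointRot (suc x) = inject₁ x

-- The clockwise rotation of σ:
--   σ_rot(x₁,…,x_r) = - σ(1, x₁+1, …, x_{r-1}+1)   if x_r = n,
--   σ_rot(x₁,…,x_r) =   σ(x₁+1, …, x_r+1)          if x_r < n.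
sigmaRot : ∀ {m k} → (Vec (Fin (suc m)) (suc k) → Sign) → Vec (Fin (suc m)) (suc k) → Sign
sigmaRot {m} σ X with does (last X Fin.≟ fromℕ m)
... | true  = opposite (σ (zero ∷ map succ (init X)))
... | false = σ (map succ X)

-- X_rot = { x_rot : x ∈ X }, as an increasing vector: if 1 ∈ X then
-- 1_rot = n becomes the new largest element, otherwise all elements shift down.
setRot : ∀ {m k} → Vec (Fin (suc m)) k → Vec (Fin (suc m)) k
setRot [] = []
setRot (zero ∷ xs) = map pointRot xs ∷ʳ pointRot zero
setRot (suc x ∷ xs) = map pointRot (suc x ∷ xs)

-- Split the (r−1)-subsets of [n] into those containing a distinguished point
-- (pinned) and those avoiding it (free): for ≺ the point is 1, for ≺_rot it is
-- n = 1_rot, and setRot carries the first splitting to the second.  On free sets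
-- both orders are generated by the deletion σ′ of 1, and a step between a free
-- set A and a pinned set leads into the pinned set iff the contraction
-- τ(A) = σ({1} ∪ A) is −, for σ and σ_rot alike.  The signotope axiom on {1} ∪ X
-- makes {A : τ(A) = +} an up-set of the order of σ′.  So a path from a free A to
-- a pinned set forces τ(A) = −, a path back forces τ(A) = +, and a path between
-- pinned sets never leaves them.  Now I ≺ J and J_rot ≺_rot I_rot would close a
-- cycle through I and J; unless both are pinned, it yields either a cycle of σ′,
-- impossible since signotope orders are acyclic (by the same decomposition and
-- induction on n), or a set with τ = + and τ = −.  Finally ≺_rot is decidable, the
-- orders being finite, which gives the dichotomy constructively.

module Submission where

open import Defs
open import Data.Nat using (ℕ; suc; zero; _≤_; z≤n; s≤s)
import Data.Nat as ℕ
open import Data.Nat.Properties using (m≤n⇒m≤1+n; ≤⇒≯)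
open import Data.Fin using (Fin; zero; suc; inject₁; fromℕ)
import Data.Fin as Fin
open import Data.Fin.Properties using (≤fromℕ; suc-injective; inject₁-injective; toℕ-inject₁; fromℕ≢inject₁; any?)
open import Data.Fin.Relation.Unary.Top using (view; ‵fromℕ; ‵inject₁)
open import Data.Vec using (Vec; []; _∷_; head; removeAt; map; tabulate; _∷ʳ_; last)
open import Data.Vec.Properties using (∷-injectiveˡ; ∷-injectiveʳ; ∷ʳ-injectiveˡ; tabulate-cong; last-∷ʳ; init-∷ʳ; ≡-dec)
open import Data.Vec.Membership.Propositional using (_∈_)
open import Data.Vec.Relation.Unary.Any using (here)
import Data.Vec.Relation.Unary.Linked as Linked
open import Data.Vec.Relation.Unary.Linked using ([-]; _∷_)
open import Data.Vec.Relation.Unary.Linked.Properties as Linkedₚ using ()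
open import Data.List using (List; []; _∷_; allFin; cartesianProductWith)
open import Data.List.Membership.Propositional using (lose) renaming (_∈_ to _∈ₗ_)
open import Data.List.Membership.Propositional.Properties using (∈-allFin; ∈-cartesianProductWith⁺)
open import Data.List.Relation.Unary.Any using (here; there; satisfied)
import Data.List.Relation.Unary.Any as Any
open import Data.Sign using (Sign; +; -; opposite)
import Data.Sign as Sign
open import Data.Sign.Properties using (s≢opposite[s]; opposite-injective)
open import Data.Empty using (⊥; ⊥-elim)
open import Data.Product using (_×_; _,_; ∃; ∃₂)
open import Data.Sum using (_⊎_; inj₁; inj₂)
open import Function using (_∘_)
open import Function.Definitions using (Injective)
open import Relation.Nullary using (¬_; Dec; yes; no; contradiction)
open import Relation.Nullary.Decidable using (_×-dec_; _⊎-dec_; map′; dec-true; dec-false)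
open import Relation.Binary.PropositionalEquality using (_≡_; _≢_; refl; sym; trans; cong; cong₂; subst; subst₂)
open import Relation.Binary.Construct.Always using (Always)
open import Relation.Binary.Construct.Closure.Transitive using (TransClosure; [_]; _∷_; _++_)

private
  variable
    A B : Set
    k m n : ℕ

≡-or-opposite : ∀ s t → t ≡ s ⊎ t ≡ opposite s
≡-or-opposite + + = inj₁ refl
≡-or-opposite + - = inj₂ refl
≡-or-opposite - + = inj₂ refl
≡-or-opposite - - = inj₁ refl

changeAt+≤0 : ∀ s t c → changeAt s t ℕ.+ c ≤ 0 → t ≡ s × c ≤ 0
changeAt+≤0 + + c c≤0 = refl , c≤0
changeAt+≤0 - - c c≤0 = refl , c≤0

changeAt+≤1 : ∀ s t c → changeAt s t ℕ.+ c ≤ 1 →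
              (t ≡ s × c ≤ 1) ⊎ (t ≡ opposite s × c ≤ 0)
changeAt+≤1 + + c c≤1 = inj₁ (refl , c≤1)
changeAt+≤1 - - c c≤1 = inj₁ (refl , c≤1)
changeAt+≤1 + - c c≤1 = inj₂ (refl , ℕ.s≤s⁻¹ c≤1)
changeAt+≤1 - + c c≤1 = inj₂ (refl , ℕ.s≤s⁻¹ c≤1)

sign-clash : ∀ {s} → s ≡ + → s ≡ - → ⊥
sign-clash refl ()

signChanges≤0⇒constant : ∀ s (f : Fin n → Sign) → signChanges (s ∷ tabulate f) ≤ 0 →
                         ∀ i → f i ≡ s
signChanges≤0⇒constant s f h zero with changeAt+≤0 s (f zero) _ h
... | refl , _ = refl
signChanges≤0⇒constant s f h (suc i) with changeAt+≤0 s (f zero) _ h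
... | refl , h′ = signChanges≤0⇒constant (f zero) (λ j → f (suc j)) h′ i

signChanges≤1-stays-opposite :
  ∀ s (f : Fin (suc n) → Sign) → signChanges (s ∷ tabulate f) ≤ 1 →
  ∀ i → f (inject₁ i) ≡ opposite s → f (suc i) ≡ opposite s
signChanges≤1-stays-opposite s f h i fi≡s̄ with changeAt+≤1 s (f zero) _ h
... | inj₂ (f0≡s̄ , h′) =
  trans (signChanges≤0⇒constant (f zero) (λ j → f (suc j)) h′ i) f0≡s̄
signChanges≤1-stays-opposite s f h zero fi≡s̄ | inj₁ (f0≡s , _) =
  contradiction (trans (sym f0≡s) fi≡s̄) (s≢opposite[s] s)
signChanges≤1-stays-opposite {suc n} s f h (suc i) fi≡s̄ | inj₁ (refl , h′) =
  signChanges≤1-stays-opposite (f zero) (λ j → f (suc j)) h′ i fi≡s̄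

signChanges≤1-stays-first :
  ∀ s (f : Fin (suc n) → Sign) → signChanges (s ∷ tabulate f) ≤ 1 →
  ∀ i → f (suc i) ≡ s → f (inject₁ i) ≡ s
signChanges≤1-stays-first s f h i fi≡s with ≡-or-opposite s (f (inject₁ i))
... | inj₁ e = e
... | inj₂ e =
  contradiction (trans (sym fi≡s) (signChanges≤1-stays-opposite s f h i e)) (s≢opposite[s] s)

signChanges≤1-tail : ∀ s (w : Vec Sign n) → signChanges (s ∷ w) ≤ 1 → signChanges w ≤ 1
signChanges≤1-tail s [] _ = z≤n
signChanges≤1-tail s (t ∷ w) h with changeAt+≤1 s t _ h
... | inj₁ (_ , h′) = h′
... | inj₂ (_ , h′) = m≤n⇒m≤1+n h′

map-injective : ∀ {f : A → B} → Injective _≡_ _≡_ f → Injective _≡_ _≡_ (map {n = n} f)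
map-injective {n = zero}  f-inj {[]}     {[]}     _  = refl
map-injective {n = suc n} f-inj {x ∷ xs} {y ∷ ys} eq =
  cong₂ _∷_ (f-inj (∷-injectiveˡ eq)) (map-injective f-inj (∷-injectiveʳ eq))

removeAt-map : ∀ (f : A → B) (xs : Vec A (suc n)) i → removeAt (map f xs) i ≡ map f (removeAt xs i)
removeAt-map f (x ∷ xs)     zero    = refl
removeAt-map f (x ∷ y ∷ xs) (suc i) = cong (f x ∷_) (removeAt-map f (y ∷ xs) i)

removeAt-∷ʳ-inject₁ : ∀ (xs : Vec A (suc n)) x i → removeAt (xs ∷ʳ x) (inject₁ i) ≡ removeAt xs i ∷ʳ x
removeAt-∷ʳ-inject₁ (y ∷ xs)     x zero    = refl
removeAt-∷ʳ-inject₁ (y ∷ z ∷ xs) x (suc i) = cong (y ∷_) (removeAt-∷ʳ-inject₁ (z ∷ xs) x i)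

removeAt-∷ʳ-fromℕ : ∀ (xs : Vec A n) x → removeAt (xs ∷ʳ x) (fromℕ n) ≡ xs
removeAt-∷ʳ-fromℕ []           x = refl
removeAt-∷ʳ-fromℕ (y ∷ [])     x = refl
removeAt-∷ʳ-fromℕ (y ∷ z ∷ xs) x = cong (y ∷_) (removeAt-∷ʳ-fromℕ (z ∷ xs) x)

last-map : ∀ (f : A → B) (xs : Vec A (suc n)) → last (map f xs) ≡ f (last xs)
last-map f (x ∷ [])     = refl
last-map f (x ∷ y ∷ xs) = last-map f (y ∷ xs)

Increasing-suc⁺ : {xs : Vec (Fin m) n} → Increasing xs → Increasing (map suc xs)
Increasing-suc⁺ = Linkedₚ.map⁺ ∘ Linked.map s≤s

Increasing-suc⁻ : {xs : Vec (Fin m) n} → Increasing (map suc xs) → Increasing xs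
Increasing-suc⁻ = Linked.map ℕ.s≤s⁻¹ ∘ Linkedₚ.map⁻

Increasing-inject₁⁻ : {xs : Vec (Fin m) n} → Increasing (map inject₁ xs) → Increasing xs
Increasing-inject₁⁻ = Linked.map (λ {i} {j} → subst₂ ℕ._<_ (toℕ-inject₁ i) (toℕ-inject₁ j)) ∘ Linkedₚ.map⁻

Increasing-zero∷suc⁺ : (xs : Vec (Fin m) n) → Increasing xs → Increasing (zero ∷ map suc xs)
Increasing-zero∷suc⁺ []       _   = [-]
Increasing-zero∷suc⁺ (x ∷ xs) xs↑ = s≤s z≤n ∷ Increasing-suc⁺ xs↑

tail-avoids-zero : ∀ {x} (xs : Vec (Fin (suc m)) n) → Increasing (x ∷ xs) → ∃ λ ys → xs ≡ map suc ys
tail-avoids-zero []           _         = [] , refl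
tail-avoids-zero (suc y ∷ xs) (_ ∷ xs↑) with tail-avoids-zero xs xs↑
... | ys , refl = y ∷ ys , refl

data FirstView {m k} : Vec (Fin (suc m)) (suc k) → Set where
  starts-first : (ys : Vec (Fin m) k) → FirstView (zero ∷ map suc ys)
  avoids-first : (xs : Vec (Fin m) (suc k)) → FirstView (map suc xs)

first-view : (xs : Vec (Fin (suc m)) (suc k)) → Increasing xs → FirstView xs
first-view (zero  ∷ xs) xs↑ with tail-avoids-zero xs xs↑
... | ys , refl = starts-first ys
first-view (suc x ∷ xs) xs↑ with tail-avoids-zero xs xs↑
... | ys , refl = avoids-first (x ∷ ys)

data LastView {m k} : Vec (Fin (suc m)) (suc k) → Set where
  ends-last   : (ys : Vec (Fin m) k) → LastView (map inject₁ ys ∷ʳ fromℕ m)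
  avoids-last : (xs : Vec (Fin m) (suc k)) → LastView (map inject₁ xs)

last-view : (xs : Vec (Fin (suc m)) (suc k)) → Increasing xs → LastView xs
last-view (x ∷ []) [-] with view x
... | ‵fromℕ     = ends-last []
... | ‵inject₁ x = avoids-last (x ∷ [])
last-view (x ∷ xs) (x<y ∷ xs↑) with view x | last-view xs xs↑
... | ‵fromℕ     | _              = contradiction x<y (≤⇒≯ (≤fromℕ (head xs)))
... | ‵inject₁ x | ends-last ys   = ends-last (x ∷ ys)
... | ‵inject₁ x | avoids-last zs = avoids-last (x ∷ zs)

-- Transitive closures and finite search

module _ {A B : Set} {_∼_ : A → A → Set} {_≈_ : B → B → Set}
         (f : B → A) (f-injective : Injective _≡_ _≡_ f)
         (lift : ∀ {a a′} → a ∼ a′ → ∃₂ λ b b′ → a ≡ f b × a′ ≡ f b′ × b ≈ b′) where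

  lift⁺ : ∀ {a a′} → TransClosure _∼_ a a′ →
          ∃₂ λ b b′ → a ≡ f b × a′ ≡ f b′ × TransClosure _≈_ b b′
  lift⁺ [ a∼a′ ] with lift a∼a′
  ... | b , b′ , refl , refl , b≈b′ = b , b′ , refl , refl , [ b≈b′ ]
  lift⁺ (a∼c ∷ c∼⁺a′) with lift a∼c | lift⁺ c∼⁺a′
  ... | b , c , refl , refl , b≈c | c′ , b′ , fc≡fc′ , refl , c′≈⁺b′ with f-injective fc≡fc′
  ... | refl = b , b′ , refl , refl , b≈c ∷ c′≈⁺b′

map⁺ : ∀ {R S : A → A → Set} → (∀ {x y} → R x y → S x y) →
       ∀ {x y} → TransClosure R x y → TransClosure S x y
map⁺ R⇒S [ x∼y ]      = [ R⇒S x∼y ]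
map⁺ R⇒S (x∼y ∷ y∼⁺z) = R⇒S x∼y ∷ map⁺ R⇒S y∼⁺z

module _ {A : Set} {_∼_ : A → A → Set} (_∼?_ : ∀ x y → Dec (x ∼ y)) where

  -- Via vs x y: a ∼-path from x to y whose inner vertices all lie in vs (Floyd–Warshall).
  Via : List A → A → A → Set
  Via []       x y = x ∼ y
  Via (v ∷ vs) x y = Via vs x y ⊎ (Via vs x v × Via vs v y)

  via? : ∀ vs x y → Dec (Via vs x y)
  via? []       x y = x ∼? y
  via? (v ∷ vs) x y = via? vs x y ⊎-dec (via? vs x v ×-dec via? vs v y)

  via⇒⁺ : ∀ vs {x y} → Via vs x y → TransClosure _∼_ x y
  via⇒⁺ []       x∼y              = [ x∼y ]
  via⇒⁺ (v ∷ vs) (inj₁ x→y)       = via⇒⁺ vs x→y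
  via⇒⁺ (v ∷ vs) (inj₂ (x→v , v→y)) = via⇒⁺ vs x→v ++ via⇒⁺ vs v→y

  ∼⇒via : ∀ vs {x y} → x ∼ y → Via vs x y
  ∼⇒via []       x∼y = x∼y
  ∼⇒via (v ∷ vs) x∼y = inj₁ (∼⇒via vs x∼y)

  ∼∷via : ∀ vs {x y z} → x ∼ y → y ∈ₗ vs → Via vs y z → Via vs x z
  ∼∷via (v ∷ vs) x∼v (here refl)  (inj₁ v→z)       = inj₂ (∼⇒via vs x∼v , v→z)
  ∼∷via (v ∷ vs) x∼v (here refl)  (inj₂ (_ , v→z)) = inj₂ (∼⇒via vs x∼v , v→z)
  ∼∷via (v ∷ vs) x∼y (there y∈vs) (inj₁ y→z)       = inj₁ (∼∷via vs x∼y y∈vs y→z)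
  ∼∷via (v ∷ vs) x∼y (there y∈vs) (inj₂ (y→v , v→z)) = inj₂ (∼∷via vs x∼y y∈vs y→v , v→z)

  ⁺⇒via : ∀ vs → (∀ x → x ∈ₗ vs) → ∀ {x y} → TransClosure _∼_ x y → Via vs x y
  ⁺⇒via vs _   [ x∼y ]                 = ∼⇒via vs x∼y
  ⁺⇒via vs all (_∷_ {y = y} x∼y y∼⁺z) = ∼∷via vs x∼y (all y) (⁺⇒via vs all y∼⁺z)

  TransClosure? : (vs : List A) → (∀ x → x ∈ₗ vs) → ∀ x y → Dec (TransClosure _∼_ x y)
  TransClosure? vs all x y = map′ (via⇒⁺ vs) (⁺⇒via vs all) (via? vs x y)

∃? : ∀ {P : A → Set} (xs : List A) → (∀ x → x ∈ₗ xs) → (∀ x → Dec (P x)) → Dec (∃ P)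
∃? xs all P? = map′ satisfied (λ (x , px) → lose (all x) px) (Any.any? P? xs)

vectors : ∀ n k → List (Vec (Fin n) k)
vectors n zero    = [] ∷ []
vectors n (suc k) = cartesianProductWith _∷_ (allFin n) (vectors n k)

∈-vectors : (xs : Vec (Fin n) k) → xs ∈ₗ vectors n k
∈-vectors []       = here refl
∈-vectors (x ∷ xs) = ∈-cartesianProductWith⁺ _∷_ (∈-allFin x) (∈-vectors xs)

Step? : (σ : Vec (Fin n) (suc k) → Sign) → ∀ A B → Dec (Step σ A B)
Step? σ A B = ∃? (vectors _ _) ∈-vectors λ X → Linked.linked? Fin._<?_ X ×-dec any? λ j →
    (σ X Sign.≟ - ×-dec A ≟ removeAt X (inject₁ j) ×-dec B ≟ removeAt X (suc j))
  ⊎-dec (σ X Sign.≟ + ×-dec A ≟ removeAt X (suc j) ×-dec B ≟ removeAt X (inject₁ j))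
  where
  _≟_ : ∀ {k} → (xs ys : Vec (Fin _) k) → Dec (xs ≡ ys)
  _≟_ = ≡-dec Fin._≟_

Prec? : (σ : Vec (Fin n) (suc k) → Sign) → ∀ A B → Dec (Prec σ A B)
Prec? σ = TransClosure? (Step? σ) (vectors _ _) ∈-vectors

succ-inject₁ : (x : Fin m) → succ (inject₁ x) ≡ suc x
succ-inject₁ {suc m} zero = refl
succ-inject₁ {suc m} (suc x) rewrite succ-inject₁ x = refl

map-succ-inject₁ : (xs : Vec (Fin m) n) → map succ (map inject₁ xs) ≡ map suc xs
map-succ-inject₁ []       = refl
map-succ-inject₁ (x ∷ xs) = cong₂ _∷_ (succ-inject₁ x) (map-succ-inject₁ xs)

map-pointRot-suc : (xs : Vec (Fin m) n) → map pointRot (map suc xs) ≡ map inject₁ xs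
map-pointRot-suc []       = refl
map-pointRot-suc (x ∷ xs) = cong (inject₁ x ∷_) (map-pointRot-suc xs)

sigmaRot-ends-last : (σ : Vec (Fin (suc m)) (suc k) → Sign) (ys : Vec (Fin m) k) →
                     sigmaRot σ (map inject₁ ys ∷ʳ fromℕ m) ≡ opposite (σ (zero ∷ map suc ys))
sigmaRot-ends-last {m} σ ys
  rewrite last-∷ʳ (fromℕ m) (map inject₁ ys) | dec-true (fromℕ m Fin.≟ fromℕ m) refl
        | init-∷ʳ (fromℕ m) (map inject₁ ys) | map-succ-inject₁ ys = refl

sigmaRot-avoids-last : (σ : Vec (Fin (suc m)) (suc k) → Sign) (xs : Vec (Fin m) (suc k)) →
                       sigmaRot σ (map inject₁ xs) ≡ σ (map suc xs)
sigmaRot-avoids-last {m} σ xs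
  rewrite last-map inject₁ xs | dec-false (inject₁ (last xs) Fin.≟ fromℕ m) (fromℕ≢inject₁ ∘ sym)
        | map-succ-inject₁ xs = refl

-- Splitting off a distinguished point

data Part (m k : ℕ) : Set where
  pinned : Vec (Fin m) k → Part m k
  free   : Vec (Fin m) (suc k) → Part m k

embedFirst : Part m k → Vec (Fin (suc m)) (suc k)
embedFirst (pinned ys) = zero ∷ map suc ys
embedFirst (free xs)   = map suc xs

embedLast : Part m k → Vec (Fin (suc m)) (suc k)
embedLast {m} (pinned ys) = map inject₁ ys ∷ʳ fromℕ m
embedLast     (free xs)   = map inject₁ xs

embedFirst-injective : Injective _≡_ _≡_ (embedFirst {m} {k})
embedFirst-injective {x = pinned _} {pinned _} eq =
  cong pinned (map-injective suc-injective (∷-injectiveʳ eq))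
embedFirst-injective {x = pinned _} {free (_ ∷ _)} ()
embedFirst-injective {x = free (_ ∷ _)} {pinned _} ()
embedFirst-injective {x = free _}   {free _}   eq = cong free (map-injective suc-injective eq)

embedLast-pinned≢free : (ys : Vec (Fin m) k) (xs : Vec (Fin m) (suc k)) →
                        embedLast (pinned ys) ≢ embedLast (free xs)
embedLast-pinned≢free []       (x ∷ []) eq = fromℕ≢inject₁ (∷-injectiveˡ eq)
embedLast-pinned≢free (y ∷ ys) (x ∷ xs) eq = embedLast-pinned≢free ys xs (∷-injectiveʳ eq)

embedLast-injective : Injective _≡_ _≡_ (embedLast {m} {k})
embedLast-injective {x = pinned ys} {pinned zs} eq =
  cong pinned (map-injective inject₁-injective (∷ʳ-injectiveˡ _ _ eq))
embedLast-injective {x = pinned ys} {free xs}   eq = contradiction eq (embedLast-pinned≢free ys xs)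
embedLast-injective {x = free xs}   {pinned ys} eq = contradiction (sym eq) (embedLast-pinned≢free ys xs)
embedLast-injective {x = free _}    {free _}    eq = cong free (map-injective inject₁-injective eq)

setRot-embedFirst : (x : Part m k) → setRot (embedFirst x) ≡ embedLast x
setRot-embedFirst (pinned ys)    = cong (_∷ʳ fromℕ _) (map-pointRot-suc ys)
setRot-embedFirst (free (x ∷ xs)) = cong (inject₁ x ∷_) (map-pointRot-suc xs)

removeAt-embedFirst-pinned : (ys : Vec (Fin m) (suc k)) (j : Fin (suc k)) →
                             removeAt (embedFirst (pinned ys)) (suc j) ≡ embedFirst (pinned (removeAt ys j))
removeAt-embedFirst-pinned (y ∷ ys) j = cong (zero ∷_) (removeAt-map suc (y ∷ ys) j)

removeAt-embedLast-pinned : (ys : Vec (Fin m) (suc k)) (j : Fin (suc k)) →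
                            removeAt (embedLast (pinned ys)) (inject₁ j) ≡ embedLast (pinned (removeAt ys j))
removeAt-embedLast-pinned {m} ys j =
  trans (removeAt-∷ʳ-inject₁ (map inject₁ ys) (fromℕ m) j) (cong (_∷ʳ fromℕ m) (removeAt-map inject₁ ys j))

-- Deletion and contraction of the first point

restrict : (Vec (Fin (suc m)) k → Sign) → Vec (Fin m) k → Sign
restrict σ xs = σ (map suc xs)

contract : (Vec (Fin (suc m)) (suc k) → Sign) → Vec (Fin m) k → Sign
contract σ ys = σ (zero ∷ map suc ys)

restrict-isSignotope : (σ : Vec (Fin (suc m)) (suc k) → Sign) →
                       IsSignotope k σ → IsSignotope k (restrict σ)
restrict-isSignotope σ σ-sig xs xs↑ =
  subst (λ w → signChanges w ≤ 1)
        (tabulate-cong (cong σ ∘ removeAt-map suc xs))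
        (σ-sig (map suc xs) (Increasing-suc⁺ xs↑))

module _ (σ : Vec (Fin (suc m)) (suc (suc k)) → Sign) (σ-sig : IsSignotope (suc k) σ) where

  -- The signotope axiom on {1} ∪ xs: removing 1 gives xs, removing x_j gives {1} ∪ (xs ∖ x_j).
  signChanges-through-first : ∀ {s} (xs : Vec (Fin m) (suc (suc k))) → Increasing xs → restrict σ xs ≡ s →
    signChanges (s ∷ tabulate (contract σ ∘ removeAt xs)) ≤ 1
  signChanges-through-first xs@(_ ∷ _) xs↑ refl =
    subst (λ w → signChanges (restrict σ xs ∷ w) ≤ 1)
          (tabulate-cong (λ j → cong (λ v → σ (zero ∷ v)) (removeAt-map suc xs j)))
          (σ-sig (zero ∷ map suc xs) (Increasing-zero∷suc⁺ xs xs↑))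

  contract-isSignotope : IsSignotope k (contract σ)
  contract-isSignotope xs xs↑ =
    signChanges≤1-tail (restrict σ xs) (tabulate (contract σ ∘ removeAt xs))
                       (signChanges-through-first xs xs↑ refl)

  contract-upward : ∀ {A B} → Step (restrict σ) A B → contract σ A ≡ + → contract σ B ≡ +
  contract-upward (xs , xs↑ , j , inj₁ (xs- , refl , refl)) =
    signChanges≤1-stays-opposite - (contract σ ∘ removeAt xs) (signChanges-through-first xs xs↑ xs-) j
  contract-upward (xs , xs↑ , j , inj₂ (xs+ , refl , refl)) =
    signChanges≤1-stays-first + (contract σ ∘ removeAt xs) (signChanges-through-first xs xs↑ xs+) j

  contract-upward⁺ : ∀ {A B} → Prec (restrict σ) A B → contract σ A ≡ + → contract σ B ≡ +
  contract-upward⁺ [ A→B ]     = contract-upward A→B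
  contract-upward⁺ (A→C ∷ C→B) = contract-upward⁺ C→B ∘ contract-upward A→C

  contract-downward : ∀ {A B} → Step (restrict σ) A B → contract σ B ≡ - → contract σ A ≡ -
  contract-downward {A} A→B B- with ≡-or-opposite - (contract σ A)
  ... | inj₁ A- = A-
  ... | inj₂ A+ = ⊥-elim (sign-clash (contract-upward A→B A+) B-)

module Decomposition {m k} (σ : Vec (Fin (suc m)) (suc (suc k)) → Sign) where

  -- Cross steps ignore which pinned set they reach, so the steps of σ (with R the steps of
  -- the contraction) and the steps of σ_rot (with R = Always) are both Link steps.
  data Link (R : Vec (Fin m) k → Vec (Fin m) k → Set) : Part m k → Part m k → Set where
    inside-pinned : ∀ {ys zs} → R ys zs → Link R (pinned ys) (pinned zs)
    enter-free    : ∀ {ys B} → contract σ B ≡ + → Link R (pinned ys) (free B)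
    leave-free    : ∀ {A ys} → contract σ A ≡ - → Link R (free A) (pinned ys)
    inside-free   : ∀ {A B} → Step (restrict σ) A B → Link R (free A) (free B)

  -- What a Link R path guarantees (reach⁺); a path between pinned sets stays pinned.
  Reach : (Vec (Fin m) k → Vec (Fin m) k → Set) → Part m k → Part m k → Set
  Reach R (pinned ys) (pinned zs) = TransClosure R ys zs
  Reach R (pinned _)  (free B)    = contract σ B ≡ +
  Reach R (free A)    (pinned _)  = contract σ A ≡ -
  Reach R (free A)    (free B)    = Prec (restrict σ) A B ⊎ (contract σ A ≡ - × contract σ B ≡ +)

  liftStep : ∀ {C D} → Step σ C D →
             ∃₂ λ x y → C ≡ embedFirst x × D ≡ embedFirst y × Link (Step (contract σ)) x y
  liftStep (X , X↑ , j , _) with first-view X X↑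
  liftStep (_ , X↑ , zero , inj₁ (X- , refl , refl)) | starts-first ys =
    free ys , pinned (removeAt ys zero) , refl , removeAt-embedFirst-pinned ys zero , leave-free X-
  liftStep (_ , X↑ , zero , inj₂ (X+ , refl , refl)) | starts-first ys =
    pinned (removeAt ys zero) , free ys , removeAt-embedFirst-pinned ys zero , refl , enter-free X+
  liftStep (_ , X↑ , suc j , inj₁ (X- , refl , refl)) | starts-first ys =
    pinned (removeAt ys (inject₁ j)) , pinned (removeAt ys (suc j)) ,
    removeAt-embedFirst-pinned ys (inject₁ j) , removeAt-embedFirst-pinned ys (suc j) ,
    inside-pinned (ys , Increasing-suc⁻ (Linked.tail X↑) , j , inj₁ (X- , refl , refl))
  liftStep (_ , X↑ , suc j , inj₂ (X+ , refl , refl)) | starts-first ys =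
    pinned (removeAt ys (suc j)) , pinned (removeAt ys (inject₁ j)) ,
    removeAt-embedFirst-pinned ys (suc j) , removeAt-embedFirst-pinned ys (inject₁ j) ,
    inside-pinned (ys , Increasing-suc⁻ (Linked.tail X↑) , j , inj₂ (X+ , refl , refl))
  liftStep (_ , X↑ , j , inj₁ (X- , refl , refl)) | avoids-first xs =
    free (removeAt xs (inject₁ j)) , free (removeAt xs (suc j)) ,
    removeAt-map suc xs (inject₁ j) , removeAt-map suc xs (suc j) ,
    inside-free (xs , Increasing-suc⁻ X↑ , j , inj₁ (X- , refl , refl))
  liftStep (_ , X↑ , j , inj₂ (X+ , refl , refl)) | avoids-first xs =
    free (removeAt xs (suc j)) , free (removeAt xs (inject₁ j)) ,
    removeAt-map suc xs (suc j) , removeAt-map suc xs (inject₁ j) ,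
    inside-free (xs , Increasing-suc⁻ X↑ , j , inj₂ (X+ , refl , refl))

  liftStepRot : ∀ {C D} → Step (sigmaRot σ) C D →
                ∃₂ λ x y → C ≡ embedLast x × D ≡ embedLast y × Link Always x y
  liftStepRot (Z , Z↑ , j , _) with last-view Z Z↑ | view j
  liftStepRot (_ , _ , _ , inj₁ (Z- , refl , refl)) | ends-last ys | ‵fromℕ =
    pinned (removeAt ys (fromℕ k)) , free ys ,
    removeAt-embedLast-pinned ys (fromℕ k) , removeAt-∷ʳ-fromℕ (map inject₁ ys) (fromℕ m) ,
    enter-free (opposite-injective (trans (sym (sigmaRot-ends-last σ ys)) Z-))
  liftStepRot (_ , _ , _ , inj₂ (Z+ , refl , refl)) | ends-last ys | ‵fromℕ =
    free ys , pinned (removeAt ys (fromℕ k)) ,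
    removeAt-∷ʳ-fromℕ (map inject₁ ys) (fromℕ m) , removeAt-embedLast-pinned ys (fromℕ k) ,
    leave-free (opposite-injective (trans (sym (sigmaRot-ends-last σ ys)) Z+))
  liftStepRot (_ , _ , _ , inj₁ (_ , refl , refl)) | ends-last ys | ‵inject₁ j =
    pinned (removeAt ys (inject₁ j)) , pinned (removeAt ys (suc j)) ,
    removeAt-embedLast-pinned ys (inject₁ j) , removeAt-embedLast-pinned ys (suc j) , inside-pinned _
  liftStepRot (_ , _ , _ , inj₂ (_ , refl , refl)) | ends-last ys | ‵inject₁ j =
    pinned (removeAt ys (suc j)) , pinned (removeAt ys (inject₁ j)) ,
    removeAt-embedLast-pinned ys (suc j) , removeAt-embedLast-pinned ys (inject₁ j) , inside-pinned _
  liftStepRot (_ , Z↑ , j , inj₁ (Z- , refl , refl)) | avoids-last xs | _ =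
    free (removeAt xs (inject₁ j)) , free (removeAt xs (suc j)) ,
    removeAt-map inject₁ xs (inject₁ j) , removeAt-map inject₁ xs (suc j) ,
    inside-free (xs , Increasing-inject₁⁻ Z↑ , j ,
                 inj₁ (trans (sym (sigmaRot-avoids-last σ xs)) Z- , refl , refl))
  liftStepRot (_ , Z↑ , j , inj₂ (Z+ , refl , refl)) | avoids-last xs | _ =
    free (removeAt xs (suc j)) , free (removeAt xs (inject₁ j)) ,
    removeAt-map inject₁ xs (suc j) , removeAt-map inject₁ xs (inject₁ j) ,
    inside-free (xs , Increasing-inject₁⁻ Z↑ , j ,
                 inj₂ (trans (sym (sigmaRot-avoids-last σ xs)) Z+ , refl , refl))

  Link-forget : ∀ {R x y} → Link R x y → Link Always x y
  Link-forget (inside-pinned _) = inside-pinned _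
  Link-forget (enter-free B+)   = enter-free B+
  Link-forget (leave-free A-)   = leave-free A-
  Link-forget (inside-free A→B) = inside-free A→B

  module _ (σ-sig : IsSignotope (suc k) σ) {R : Vec (Fin m) k → Vec (Fin m) k → Set} where

    link⇒reach : ∀ {x y} → Link R x y → Reach R x y
    link⇒reach (inside-pinned ys→zs) = [ ys→zs ]
    link⇒reach (enter-free B+)       = B+
    link⇒reach (leave-free A-)       = A-
    link⇒reach (inside-free A→B)     = inj₁ [ A→B ]

    link∷reach : ∀ {x y z} → Link R x y → Reach R y z → Reach R x z
    link∷reach {z = pinned _} (inside-pinned x→y) y→z              = x→y ∷ y→z
    link∷reach {z = free _}   (inside-pinned _)   z+               = z+
    link∷reach {z = pinned _} (enter-free y+)     y-               = ⊥-elim (sign-clash y+ y-)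
    link∷reach {z = free _}   (enter-free y+)     (inj₁ y→z)       = contract-upward⁺ σ σ-sig y→z y+
    link∷reach {z = free _}   (enter-free _)      (inj₂ (_ , z+))  = z+
    link∷reach {z = pinned _} (leave-free x-)     _                = x-
    link∷reach {z = free _}   (leave-free x-)     z+               = inj₂ (x- , z+)
    link∷reach {z = pinned _} (inside-free x→y)   y-               = contract-downward σ σ-sig x→y y-
    link∷reach {z = free _}   (inside-free x→y)   (inj₁ y→z)       = inj₁ (x→y ∷ y→z)
    link∷reach {z = free _}   (inside-free x→y)   (inj₂ (y- , z+)) =
      inj₂ (contract-downward σ σ-sig x→y y- , z+)

    reach⁺ : ∀ {x y} → TransClosure (Link R) x y → Reach R x y
    reach⁺ [ x→y ]       = link⇒reach x→y
    reach⁺ (x→y ∷ y→⁺z) = link∷reach x→y (reach⁺ y→⁺z)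

    free-acyclic : (∀ {A} → ¬ Prec (restrict σ) A A) →
                   ∀ {A} → ¬ TransClosure (Link R) (free A) (free A)
    free-acyclic restrict-irrefl cycle with reach⁺ cycle
    ... | inj₁ A→A       = restrict-irrefl A→A
    ... | inj₂ (A- , A+) = sign-clash A+ A-

    link-acyclic : (∀ {A} → ¬ Prec (restrict σ) A A) → (∀ {ys} → ¬ TransClosure R ys ys) →
                   ∀ x → ¬ TransClosure (Link R) x x
    link-acyclic _               R-irrefl (pinned _) = R-irrefl ∘ reach⁺
    link-acyclic restrict-irrefl _        (free _)   = free-acyclic restrict-irrefl

Prec-irrefl : ∀ {n k} {σ : Vec (Fin n) (suc k) → Sign} → IsSignotope k σ → ∀ {A} → ¬ Prec σ A A
Prec-irrefl {zero}        _ [ (() ∷ _) , _ ]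
Prec-irrefl {zero}        _ (((() ∷ _) , _) ∷ _)
Prec-irrefl {suc m} {zero} _ [ _ , _ , () , _ ]
Prec-irrefl {suc m} {zero} _ ((_ , _ , () , _) ∷ _)
Prec-irrefl {suc m} {suc k} {σ} σ-sig A→A
  with lift⁺ embedFirst embedFirst-injective (Decomposition.liftStep σ) A→A
... | x , y , refl , x≡y , x→y with embedFirst-injective {x = x} {y} x≡y
... | refl = Decomposition.link-acyclic σ σ-sig
               (Prec-irrefl (restrict-isSignotope σ σ-sig))
               (Prec-irrefl (contract-isSignotope σ σ-sig)) x x→y

no-round-trip : ∀ {m k} (σ : Vec (Fin (suc m)) (suc (suc k)) → Sign) → IsSignotope (suc k) σ →
  ∀ x y → ¬ (zero ∈ embedFirst x × zero ∈ embedFirst y) →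
  TransClosure (Decomposition.Link σ Always) x y → ¬ TransClosure (Decomposition.Link σ Always) y x
no-round-trip σ σ-sig (pinned _) (pinned _) not-both _ _ = not-both (here refl , here refl)
no-round-trip σ σ-sig (pinned _) (free _)   _ x→y y→x =
  sign-clash (Decomposition.reach⁺ σ σ-sig x→y) (Decomposition.reach⁺ σ σ-sig y→x)
no-round-trip σ σ-sig (free _)   _          _ x→y y→x =
  Decomposition.free-acyclic σ σ-sig (Prec-irrefl (restrict-isSignotope σ σ-sig)) (x→y ++ y→x)

rotation-cannot-reverse : (σ : Vec (Fin (suc m)) (suc k) → Sign) → IsSignotope k σ → ∀ {I J} →
  Prec σ I J → ¬ (zero ∈ I × zero ∈ J) → ¬ Prec (sigmaRot σ) (setRot J) (setRot I)
rotation-cannot-reverse {k = zero} _ _ [ _ , _ , () , _ ]       _ _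
rotation-cannot-reverse {k = zero} _ _ ((_ , _ , () , _) ∷ _) _ _
rotation-cannot-reverse {k = suc k} σ σ-sig I≺J not-both J′≺I′
  with lift⁺ embedFirst embedFirst-injective (Decomposition.liftStep σ) I≺J
... | x , y , refl , refl , x→y
  with lift⁺ embedLast embedLast-injective (Decomposition.liftStepRot σ) J′≺I′
... | y′ , x′ , y′≡ , x′≡ , y′→x′
  with embedLast-injective {x = y} {y′} (trans (sym (setRot-embedFirst y)) y′≡)
     | embedLast-injective {x = x} {x′} (trans (sym (setRot-embedFirst x)) x′≡)
... | refl | refl =
  no-round-trip σ σ-sig x y not-both (map⁺ (Decomposition.Link-forget σ) x→y) y′→x′

proposition10 : ∀ (m k : ℕ) (σ : Vec (Fin (suc m)) (suc k) → Sign) →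
    IsSignotope k σ →
    (I J : Vec (Fin (suc m)) k) → Increasing I → Increasing J →
    Prec σ I J →
    ¬ (zero ∈ I × zero ∈ J) →
    (¬ Prec (sigmaRot σ) (setRot I) (setRot J) × ¬ Prec (sigmaRot σ) (setRot J) (setRot I))
      ⊎ Prec (sigmaRot σ) (setRot I) (setRot J)
proposition10 m k σ σ-sig I J _ _ I≺J not-both with Prec? (sigmaRot σ) (setRot I) (setRot J)
... | yes I′≺J′ = inj₂ I′≺J′
... | no  I′⊀J′ = inj₁ (I′⊀J′ , rotation-cannot-reverse σ σ-sig I≺J not-both)
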